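{- Let $a,b,\ell$ be positive integers with $a\ge 2$, $b\ge 3$ and $\ell\ge 1$, let $\Delta=\mathbb{Z}/b\mathbb{Z}=\{0,1,\ldots,b-1\}$ (all arithmetic on elements of $\Delta$ is modulo $b$), and let $$T=\{(\underbrace{0,\ldots,0}_{\ell+1},1)\}\cup\{(x,\underbrace{x-1,\ldots,x-1}_{\ell},x+1):1\le x\le b-1\}\subseteq\Delta^{\ell+2}.$$ Suppose there exists a subset $N\subseteq\Delta^{\ell+2}$ with $|N|=ab$ such that: (i) for every $i\in\Delta$ and every $1\le j\le \ell+2$, exactly $a$ elements of $N$ have $i$ in the $j$th coordinate; (ii) $T\subseteq N$; (iii) if $(n_1,\ldots,n_{\ell+2})\in N\setminus T$, then $n_{\ell+2}\ne n_1+1$; (iv) there is a constant $c\ne 1$ such that for every $x\in\Delta$, the number of elements of $N$ whose first and last coordinates are both equal to $x$ is $c$; (v) for every $x\in\Delta$ and every $i\in\Delta\setminus\{0,1\}$, the number of elements $(x,n_2,\ldots,n_{\ell+2})\in N$ with $n_{\ell+2}=x+i$ is neither $1$ nor $c$. Then $\mathrm{b}(a,b)\le \ell+2$.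
   Context: $\mathrm{b}(a,b)$ denotes the base size (smallest cardinality of a subset whose pointwise stabilizer is trivial) of $\mathrm{Sym}(ab)$ acting on the set of partitions of $\{1,\ldots,ab\}$ into $b$ parts each of cardinality $a$. -}

module Defs where

open import Data.Nat using (ℕ; zero; suc; _+_; _*_; _∸_; _≤_; NonZero)
open import Data.Nat.DivMod using (_mod_)
open import Data.Fin using (Fin; toℕ)
open import Data.Fin.Permutation using (Permutation′; _⟨$⟩ʳ_)
open import Data.Fin.Properties using () renaming (_≟_ to _≟ᶠ_)
open import Data.List using (List; length; filter; allFin)
open import Data.List.Membership.Propositional using (_∈_)
open import Data.List.Relation.Unary.Any using (Any)
open import Data.Vec using (Vec; _∷_; _∷ʳ_; replicate; head; last)
open import Data.Vec.Relation.Unary.All using (All)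
open import Data.Product using (Σ; ∃; _×_; _,_)
open import Data.Sum using (_⊎_)
open import Function.Bundles using (_⇔_)
open import Relation.Binary.PropositionalEquality using (_≡_; _≢_)
open import Relation.Nullary using (¬_)
open import Relation.Unary using (Pred; Decidable)
open import Level using (0ℓ)

count : {A : Set} {P : Pred A 0ℓ} → Decidable P → List A → ℕ
count P? xs = length (filter P? xs)

-- A partition of Fin (a*b) into b blocks of size a, given by a labelling
-- of the points by block labels in Fin b; every block has exactly a points.
-- (Different labellings may give the same partition; everything below
-- only depends on the induced "same block" relation.)
Partition : ℕ → ℕ → Set
Partition a b =
  Σ (Fin (a * b) → Fin b) λ f →
    ∀ (i : Fin b) → count (λ x → f x ≟ᶠ i) (allFin (a * b)) ≡ a

-- σ fixes the partition P (as a set of blocks), i.e. P^σ = P: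
-- σ maps blocks onto blocks, i.e. x ~ y ⇔ σx ~ σy.
Fixes : ∀ {a b} → Permutation′ (a * b) → Partition a b → Set
Fixes σ (f , _) = ∀ x y → (f (σ ⟨$⟩ʳ x) ≡ f (σ ⟨$⟩ʳ y)) ⇔ (f x ≡ f y)

IsBase : ∀ {a b m} → Vec (Partition a b) m → Set
IsBase {a} {b} B =
  ∀ (σ : Permutation′ (a * b)) → All (Fixes σ) B → ∀ x → σ ⟨$⟩ʳ x ≡ x

-- b(a,b) ≤ k : there is a base of cardinality at most k
-- (b(a,b) is the minimum cardinality of a base).
BaseSize≤ : ℕ → ℕ → ℕ → Set
BaseSize≤ a b k = Σ ℕ λ m → m ≤ k × Σ (Vec (Partition a b) m) IsBase

[_]ᵇ : ∀ {b} .{{_ : NonZero b}} → ℕ → Fin b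
[_]ᵇ {b} k = k mod b

_⊕_ : ∀ {b} .{{_ : NonZero b}} → Fin b → ℕ → Fin b
_⊕_ {b} x k = (toℕ x + k) mod b

_⊖1 : ∀ {b} .{{_ : NonZero b}} → Fin b → Fin b
_⊖1 {b} x = x ⊕ (b ∸ 1)

Tuple : ℕ → ℕ → Set
Tuple b ℓ = Vec (Fin b) (2 + ℓ)

shape : ∀ {b} ℓ → Fin b → Fin b → Fin b → Tuple b ℓ
shape ℓ u v w = u ∷ (replicate ℓ v ∷ʳ w)

InT : ∀ {b} .{{_ : NonZero b}} ℓ → Tuple b ℓ → Set
InT ℓ t =
  t ≡ shape ℓ [ 0 ]ᵇ [ 0 ]ᵇ [ 1 ]ᵇ
  ⊎ ∃ λ x → x ≢ [ 0 ]ᵇ × t ≡ shape ℓ x (x ⊖1) (x ⊕ 1)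

-- Label the ab points by the tuples of N; by (i) each coordinate j then partitions them into
-- b blocks of size a.  A permutation σ fixing all ℓ + 2 partitions acts on the values of each
-- coordinate by a bijection πⱼ, so the number M x y of tuples with first entry x and last entry
-- y satisfies M x y = M (π₀ x) (πₗ y).  By (iii)-(v), M takes the value c exactly on the
-- diagonal and the value 1 exactly at y = x + 1; hence πₗ = π₀ and π₀ (x + 1) = π₀ x + 1, and
-- σ maps the element of T with first entry x to the one with first entry π₀ x.  The middle
-- entries of T agree at x = 0 and x = 1 and nowhere else, which forces π₀ 0 = 0, so π₀ is the
-- identity; then so is every πⱼ, and since distinct points carry distinct tuples, σ = id.
module Submission where

open import Defs
open import Data.Nat using (ℕ; zero; suc; _≤_; _<_; _*_; _+_; _∸_; _%_; NonZero; z≤n; s≤s; >-nonZero⁻¹)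
open import Data.Nat.Properties using (≤-trans; ≤-reflexive; <⇒≢; +-comm; +-assoc; +-identityʳ; n≤1+n; m+[n∸m]≡n; m∸n+n≡m; <⇒≤; +-0-commutativeMonoid)
open import Data.Nat.DivMod using (%-distribˡ-+; m%n%n≡m%n; [m+n]%n≡m%n; m<n⇒m%n≡m)
open import Data.Fin using (Fin; zero; suc; toℕ; fromℕ; cast)
open import Data.Fin.Properties using (_≟_; toℕ-fromℕ<; toℕ-injective; toℕ<n; cast-is-id; cast-involutive)
open import Data.Fin.Permutation using (Permutation′; _⟨$⟩ʳ_)
open import Data.Vec as Vec using (Vec; _∷_; head; last; lookup; replicate)
open import Data.Vec.Properties using (last-∷ʳ; ≡-dec)
open import Data.Vec.Relation.Binary.Pointwise.Extensional using (ext; Pointwise-≡⇒≡)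
open import Data.Vec.Relation.Unary.All.Properties using (tabulate⁻)
open import Data.List as List using (List; []; _∷_; length; allFin; tabulate)
open import Data.List.Properties using (filter-≐; filter-accept; filter-reject; filter-none; tabulate-cong; tabulate-lookup)
open import Data.List.Membership.Propositional using (_∈_)
open import Data.List.Membership.Propositional.Properties using (∈-lookup)
open import Data.List.Relation.Unary.Any using (Any; here; there; index; satisfied)
open import Data.List.Relation.Unary.Any.Properties using (lookup-index)
open import Data.List.Relation.Unary.All as All using ()
open import Data.List.Relation.Unary.AllPairs using (_∷_)
open import Data.List.Relation.Unary.Unique.Propositional using (Unique)
open import Data.Product using (Σ; ∃; _×_; _,_; proj₁; proj₂)
open import Data.Sum using (inj₁; inj₂; _⊎_)
open import Data.Empty using (⊥-elim)
open import Function using (_∘_; id)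
open import Function.Bundles using (_⇔_; Equivalence)
open import Level using (0ℓ)
open import Relation.Binary.Definitions using (DecidableEquality)
open import Relation.Binary.PropositionalEquality
open import Relation.Nullary using (¬_; Dec; yes; no)
open import Relation.Nullary.Decidable using (_×-dec_)
open import Relation.Unary using (Pred; Decidable; _≐_)
open import Algebra.Properties.CommutativeMonoid.Sum +-0-commutativeMonoid using (sum; sum-permute)

open ≡-Reasoning

indicator : {Q : Set} → Dec Q → ℕ
indicator (yes _) = 1
indicator (no _)  = 0

module _ {A : Set} {P : Pred A 0ℓ} (P? : Decidable P) where

  0<count⇒Any : ∀ xs → 0 < count P? xs → Any P xs
  0<count⇒Any []       ()
  0<count⇒Any (x ∷ xs) pos with P? x
  ... | yes Px = here Px
  ... | no  _  = there (0<count⇒Any xs pos)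

  count≡1 : ∀ {xs v} → Unique xs → v ∈ xs → P v → (∀ {u} → u ∈ xs → P u → u ≡ v) →
            count P? xs ≡ 1
  count≡1 {x ∷ xs} (x∉xs ∷ _) (here refl) Pv only = begin
    count P? (x ∷ xs)  ≡⟨ cong length (filter-accept P? Pv) ⟩
    suc (count P? xs)  ≡⟨ cong (suc ∘ length) (filter-none P? (All.tabulate λ u∈xs Pu →
                            All.lookup x∉xs u∈xs (sym (only (there u∈xs) Pu)))) ⟩
    1                  ∎
  count≡1 {x ∷ xs} (x∉xs ∷ xs-unique) (there v∈xs) Pv only = begin
    count P? (x ∷ xs)  ≡⟨ cong length (filter-reject P? (All.lookup x∉xs v∈xs ∘ only (here refl))) ⟩
    count P? xs        ≡⟨ count≡1 xs-unique v∈xs Pv (λ u∈xs → only (there u∈xs)) ⟩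
    1                  ∎

  count-tabulate : ∀ {n} (g : Fin n → A) → count P? (tabulate g) ≡ sum (λ i → indicator (P? (g i)))
  count-tabulate {zero}  g = refl
  count-tabulate {suc n} g with P? (g zero)
  ... | yes _ = cong suc (count-tabulate (g ∘ suc))
  ... | no  _ = count-tabulate (g ∘ suc)

count-permute : ∀ {n} {P : Pred (Fin n) 0ℓ} (P? : Decidable P) (σ : Permutation′ n) →
                count (P? ∘ (σ ⟨$⟩ʳ_)) (allFin n) ≡ count P? (allFin n)
count-permute {n} P? σ = begin
  count (P? ∘ (σ ⟨$⟩ʳ_)) (allFin n)      ≡⟨ count-tabulate (P? ∘ (σ ⟨$⟩ʳ_)) id ⟩
  sum (λ i → indicator (P? (σ ⟨$⟩ʳ i)))  ≡⟨ sum-permute (λ i → indicator (P? i)) σ ⟨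
  sum (λ i → indicator (P? i))           ≡⟨ count-tabulate P? id ⟨
  count P? (allFin n)                    ∎

lookup-injective : ∀ {A : Set} {xs : List A} → Unique xs →
                   ∀ {i j} → List.lookup xs i ≡ List.lookup xs j → i ≡ j
lookup-injective (_ ∷ _)          {zero}  {zero}  _ = refl
lookup-injective (x∉xs ∷ _)       {zero}  {suc j} e = ⊥-elim (All.lookup x∉xs (∈-lookup j) e)
lookup-injective (x∉xs ∷ _)       {suc i} {zero}  e = ⊥-elim (All.lookup x∉xs (∈-lookup i) (sym e))
lookup-injective (_ ∷ xs-unique) {suc i} {suc j} e = cong suc (lookup-injective xs-unique e)

module Enumeration {A : Set} (xs : List A) {n : ℕ} (|xs| : length xs ≡ n) where

  pt : Fin n → A
  pt k = List.lookup xs (cast (sym |xs|) k)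

  pt-∈ : ∀ k → pt k ∈ xs
  pt-∈ k = ∈-lookup _

  pt-surjective : ∀ {v} → v ∈ xs → ∃ λ k → pt k ≡ v
  pt-surjective v∈xs =
    cast |xs| (index v∈xs) ,
    trans (cong (List.lookup xs) (cast-involutive (sym |xs|) |xs| _)) (sym (lookup-index v∈xs))

  pt-injective : Unique xs → ∀ {k k′} → pt k ≡ pt k′ → k ≡ k′
  pt-injective xs-unique {k} {k′} e = begin
    k                               ≡⟨ cast-involutive |xs| (sym |xs|) k ⟨
    cast |xs| (cast (sym |xs|) k)   ≡⟨ cong (cast |xs|) (lookup-injective xs-unique e) ⟩
    cast |xs| (cast (sym |xs|) k′)  ≡⟨ cast-involutive |xs| (sym |xs|) k′ ⟩
    k′                              ∎

  tabulate-pt : tabulate pt ≡ xs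
  tabulate-pt = go |xs|
    where
    go : ∀ {m} (e : length xs ≡ m) → tabulate (List.lookup xs ∘ cast (sym e)) ≡ xs
    go refl = trans (tabulate-cong (cong (List.lookup xs) ∘ cast-is-id refl)) (tabulate-lookup xs)

  count-pt : ∀ {P : Pred A 0ℓ} (P? : Decidable P) → count (P? ∘ pt) (allFin n) ≡ count P? xs
  count-pt P? = begin
    count (P? ∘ pt) (allFin n)         ≡⟨ count-tabulate (P? ∘ pt) id ⟩
    sum (λ k → indicator (P? (pt k)))  ≡⟨ count-tabulate P? pt ⟨
    count P? (tabulate pt)             ≡⟨ cong (count P?) tabulate-pt ⟩
    count P? xs                        ∎

  count-transport : ∀ {P Q : Pred A 0ℓ} (P? : Decidable P) (Q? : Decidable Q) (σ : Permutation′ n) →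
                    (P ∘ pt) ≐ (Q ∘ pt ∘ (σ ⟨$⟩ʳ_)) → count P? xs ≡ count Q? xs
  count-transport P? Q? σ P≐Qσ = begin
    count P? xs                             ≡⟨ count-pt P? ⟨
    count (P? ∘ pt) (allFin n)              ≡⟨ cong length (filter-≐ (P? ∘ pt) (Q? ∘ pt ∘ (σ ⟨$⟩ʳ_)) P≐Qσ (allFin n)) ⟩
    count (Q? ∘ pt ∘ (σ ⟨$⟩ʳ_)) (allFin n)  ≡⟨ count-permute (Q? ∘ pt) σ ⟩
    count (Q? ∘ pt) (allFin n)              ≡⟨ count-pt Q? ⟩
    count Q? xs                             ∎

module Induced {n b : ℕ} (f : Fin n → Fin b) (f-surjective : ∀ i → ∃ λ k → f k ≡ i)
  (σ : Permutation′ n) (σ-fixes : ∀ x y → (f (σ ⟨$⟩ʳ x) ≡ f (σ ⟨$⟩ʳ y)) ⇔ (f x ≡ f y)) where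

  induced : Fin b → Fin b
  induced i = f (σ ⟨$⟩ʳ proj₁ (f-surjective i))

  induced-comm : ∀ k → f (σ ⟨$⟩ʳ k) ≡ induced (f k)
  induced-comm k = Equivalence.from (σ-fixes k _) (sym (proj₂ (f-surjective (f k))))

  induced-injective : ∀ {i j} → induced i ≡ induced j → i ≡ j
  induced-injective {i} {j} e =
    trans (sym (proj₂ (f-surjective i))) (trans (Equivalence.to (σ-fixes _ _) e) (proj₂ (f-surjective j)))

fixes-all-but-one⇒id : ∀ {A : Set} → DecidableEquality A → ∀ {f : A → A} →
                       (∀ {x y} → f x ≡ f y → x ≡ y) →
                       ∀ p → (∀ y → y ≢ p → f y ≡ y) → ∀ y → f y ≡ y
fixes-all-but-one⇒id _≟ᴬ_ {f} f-injective p fixed y with y ≟ᴬ p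
... | no y≢p = fixed y y≢p
... | yes refl with f y ≟ᴬ y
...   | yes fy≡y = fy≡y
...   | no  fy≢y = ⊥-elim (fy≢y (f-injective (fixed (f y) fy≢y)))

head≡lookup-zero : ∀ {A : Set} {n} (xs : Vec A (suc n)) → head xs ≡ lookup xs zero
head≡lookup-zero (x ∷ xs) = refl

last≡lookup-fromℕ : ∀ {A : Set} {n} (xs : Vec A (suc n)) → last xs ≡ lookup xs (fromℕ n)
last≡lookup-fromℕ {n = zero}  (x ∷ Vec.[]) = refl
last≡lookup-fromℕ {n = suc n} (x ∷ xs)     = last≡lookup-fromℕ xs

last-shape : ∀ {b} ℓ (u v w : Fin b) → last (shape ℓ u v w) ≡ w
last-shape ℓ u v w = last-∷ʳ w (replicate ℓ v)

shape-coordinate : ∀ ℓ (j : Fin (2 + ℓ)) →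
                   j ≡ zero ⊎ j ≡ fromℕ (suc ℓ) ⊎ (∀ {b} (u v w : Fin b) → lookup (shape ℓ u v w) j ≡ v)
shape-coordinate zero    zero       = inj₁ refl
shape-coordinate zero    (suc zero) = inj₂ (inj₁ refl)
shape-coordinate (suc ℓ) zero       = inj₁ refl
shape-coordinate (suc ℓ) (suc j) with shape-coordinate ℓ j
... | inj₁ refl            = inj₂ (inj₂ λ u v w → refl)
... | inj₂ (inj₁ refl)     = inj₂ (inj₁ refl)
... | inj₂ (inj₂ middle)   = inj₂ (inj₂ λ u v w → middle v v w)

module ZMod (b : ℕ) .{{_ : NonZero b}} where

  toℕ-[k] : ∀ {k} → k < b → toℕ ([_]ᵇ {b} k) ≡ k
  toℕ-[k] k<b = trans (toℕ-fromℕ< _) (m<n⇒m%n≡m k<b)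

  toℕ-[0] : toℕ ([_]ᵇ {b} 0) ≡ 0
  toℕ-[0] = toℕ-[k] (>-nonZero⁻¹ b)

  toℕ-⊕ : ∀ (x : Fin b) k → toℕ (x ⊕ k) ≡ (toℕ x + k) % b
  toℕ-⊕ x k = toℕ-fromℕ< _

  [m%b+n]%b≡[m+n]%b : ∀ m n → (m % b + n) % b ≡ (m + n) % b
  [m%b+n]%b≡[m+n]%b m n = begin
    (m % b + n) % b          ≡⟨ %-distribˡ-+ (m % b) n b ⟩
    (m % b % b + n % b) % b  ≡⟨ cong (λ z → (z + n % b) % b) (m%n%n≡m%n m b) ⟩
    (m % b + n % b) % b      ≡⟨ %-distribˡ-+ m n b ⟨
    (m + n) % b              ∎

  [m+n%b]%b≡[m+n]%b : ∀ m n → (m + n % b) % b ≡ (m + n) % b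
  [m+n%b]%b≡[m+n]%b m n = begin
    (m + n % b) % b  ≡⟨ cong (_% b) (+-comm m (n % b)) ⟩
    (n % b + m) % b  ≡⟨ [m%b+n]%b≡[m+n]%b n m ⟩
    (n + m) % b      ≡⟨ cong (_% b) (+-comm n m) ⟩
    (m + n) % b      ∎

  ⊕-assoc : ∀ (x : Fin b) k m → (x ⊕ k) ⊕ m ≡ x ⊕ (k + m)
  ⊕-assoc x k m = toℕ-injective (begin
    toℕ ((x ⊕ k) ⊕ m)          ≡⟨ toℕ-⊕ (x ⊕ k) m ⟩
    (toℕ (x ⊕ k) + m) % b      ≡⟨ cong (λ z → (z + m) % b) (toℕ-⊕ x k) ⟩
    ((toℕ x + k) % b + m) % b  ≡⟨ [m%b+n]%b≡[m+n]%b (toℕ x + k) m ⟩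
    (toℕ x + k + m) % b        ≡⟨ cong (_% b) (+-assoc (toℕ x) k m) ⟩
    (toℕ x + (k + m)) % b      ≡⟨ toℕ-⊕ x (k + m) ⟨
    toℕ (x ⊕ (k + m))          ∎)

  ⊕-comm : ∀ (x : Fin b) k m → (x ⊕ k) ⊕ m ≡ (x ⊕ m) ⊕ k
  ⊕-comm x k m = trans (⊕-assoc x k m) (trans (cong (x ⊕_) (+-comm k m)) (sym (⊕-assoc x m k)))

  ⊕-identityʳ : ∀ (x : Fin b) → x ⊕ 0 ≡ x
  ⊕-identityʳ x = toℕ-injective (trans (toℕ-⊕ x 0)
    (trans (cong (_% b) (+-identityʳ (toℕ x))) (m<n⇒m%n≡m (toℕ<n x))))

  x⊕b≡x : ∀ (x : Fin b) → x ⊕ b ≡ x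
  x⊕b≡x x = toℕ-injective (trans (toℕ-⊕ x b) (trans ([m+n]%n≡m%n (toℕ x) b) (m<n⇒m%n≡m (toℕ<n x))))

  ⊕1-⊖1 : ∀ (x : Fin b) → (x ⊕ 1) ⊖1 ≡ x
  ⊕1-⊖1 x = trans (⊕-assoc x 1 (b ∸ 1)) (trans (cong (x ⊕_) (m+[n∸m]≡n (>-nonZero⁻¹ b))) (x⊕b≡x x))

  ⊖1-⊕1 : ∀ (x : Fin b) → (x ⊖1) ⊕ 1 ≡ x
  ⊖1-⊕1 x = trans (⊕-assoc x (b ∸ 1) 1) (trans (cong (x ⊕_) (m∸n+n≡m (>-nonZero⁻¹ b))) (x⊕b≡x x))

  ⊖1≡⇒≡⊕1 : ∀ {x y : Fin b} → x ⊖1 ≡ y → x ≡ y ⊕ 1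
  ⊖1≡⇒≡⊕1 {x} e = trans (sym (⊖1-⊕1 x)) (cong (_⊕ 1) e)

  [toℕ]≡ : ∀ (x : Fin b) → [ toℕ x ]ᵇ ≡ x
  [toℕ]≡ x = toℕ-injective (toℕ-[k] (toℕ<n x))

  [k]⊕1≡[1+k] : ∀ k → [_]ᵇ {b} k ⊕ 1 ≡ [ suc k ]ᵇ
  [k]⊕1≡[1+k] k = toℕ-injective (begin
    toℕ ([ k ]ᵇ ⊕ 1)          ≡⟨ toℕ-⊕ [ k ]ᵇ 1 ⟩
    (toℕ ([_]ᵇ {b} k) + 1) % b  ≡⟨ cong (λ z → (z + 1) % b) (toℕ-fromℕ< _) ⟩
    (k % b + 1) % b           ≡⟨ [m%b+n]%b≡[m+n]%b k 1 ⟩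
    (k + 1) % b               ≡⟨ cong (_% b) (+-comm k 1) ⟩
    suc k % b                 ≡⟨ toℕ-fromℕ< _ ⟨
    toℕ ([_]ᵇ {b} (suc k))    ∎)

  difference : ∀ (x y : Fin b) → ∃ λ (i : Fin b) → y ≡ x ⊕ toℕ i
  difference x y = [ d ]ᵇ , toℕ-injective (sym (begin
    toℕ (x ⊕ toℕ ([_]ᵇ {b} d))       ≡⟨ toℕ-⊕ x _ ⟩
    (toℕ x + toℕ ([_]ᵇ {b} d)) % b    ≡⟨ cong (λ z → (toℕ x + z) % b) (toℕ-fromℕ< _) ⟩
    (toℕ x + d % b) % b              ≡⟨ [m+n%b]%b≡[m+n]%b (toℕ x) d ⟩
    (toℕ x + d) % b                  ≡⟨ cong (_% b) (+-assoc (toℕ x) (b ∸ toℕ x) (toℕ y)) ⟨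
    (toℕ x + (b ∸ toℕ x) + toℕ y) % b ≡⟨ cong (λ z → (z + toℕ y) % b) (m+[n∸m]≡n (<⇒≤ (toℕ<n x))) ⟩
    (b + toℕ y) % b                  ≡⟨ cong (_% b) (+-comm b (toℕ y)) ⟩
    (toℕ y + b) % b                  ≡⟨ [m+n]%n≡m%n (toℕ y) b ⟩
    toℕ y % b                        ≡⟨ m<n⇒m%n≡m (toℕ<n y) ⟩
    toℕ y                            ∎))
    where
    d = b ∸ toℕ x + toℕ y

  x⊕k≡x⇒y⊕k≡y : ∀ {k} {x : Fin b} (y : Fin b) → x ⊕ k ≡ x → y ⊕ k ≡ y
  x⊕k≡x⇒y⊕k≡y {k} {x} y x⊕k≡x with difference x y
  ... | i , refl = trans (⊕-comm x (toℕ i) k) (cong (_⊕ toℕ i) x⊕k≡x)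

  x⊕k≢x : ∀ {k} (x : Fin b) → 0 < k → k < b → x ⊕ k ≢ x
  x⊕k≢x {k} x 0<k k<b x⊕k≡x = <⇒≢ 0<k (sym (begin
    k                          ≡⟨ m<n⇒m%n≡m k<b ⟨
    k % b                      ≡⟨ cong (λ z → (z + k) % b) toℕ-[0] ⟨
    (toℕ ([_]ᵇ {b} 0) + k) % b  ≡⟨ toℕ-⊕ [ 0 ]ᵇ k ⟨
    toℕ ([ 0 ]ᵇ ⊕ k)           ≡⟨ cong toℕ (x⊕k≡x⇒y⊕k≡y [ 0 ]ᵇ x⊕k≡x) ⟩
    toℕ ([_]ᵇ {b} 0)           ≡⟨ toℕ-[0] ⟩
    0                          ∎))

  ⊕1-equivariant⇒id : ∀ {f : Fin b → Fin b} → f [ 0 ]ᵇ ≡ [ 0 ]ᵇ → (∀ x → f (x ⊕ 1) ≡ f x ⊕ 1) →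
                      ∀ x → f x ≡ x
  ⊕1-equivariant⇒id {f} f[0]≡[0] f-⊕1 x =
    trans (cong f (sym ([toℕ]≡ x))) (trans (fixes-[k] (toℕ x)) ([toℕ]≡ x))
    where
    fixes-[k] : ∀ k → f [ k ]ᵇ ≡ [ k ]ᵇ
    fixes-[k] zero    = f[0]≡[0]
    fixes-[k] (suc k) = begin
      f [ suc k ]ᵇ    ≡⟨ cong f ([k]⊕1≡[1+k] k) ⟨
      f ([ k ]ᵇ ⊕ 1)  ≡⟨ f-⊕1 [ k ]ᵇ ⟩
      f [ k ]ᵇ ⊕ 1    ≡⟨ cong (_⊕ 1) (fixes-[k] k) ⟩
      [ k ]ᵇ ⊕ 1      ≡⟨ [k]⊕1≡[1+k] k ⟩
      [ suc k ]ᵇ      ∎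

  -- The middle entries of the element of T with first entry x.
  mid : Fin b → Fin b
  mid x with x ≟ [ 0 ]ᵇ
  ... | yes _ = [ 0 ]ᵇ
  ... | no  _ = x ⊖1

  mid-[0] : mid [ 0 ]ᵇ ≡ [ 0 ]ᵇ
  mid-[0] with [_]ᵇ {b} 0 ≟ [ 0 ]ᵇ
  ... | yes _   = refl
  ... | no  0≢0 = ⊥-elim (0≢0 refl)

  mid-≢0 : ∀ {x} → x ≢ [ 0 ]ᵇ → mid x ≡ x ⊖1
  mid-≢0 {x} x≢0 with x ≟ [ 0 ]ᵇ
  ... | yes x≡0 = ⊥-elim (x≢0 x≡0)
  ... | no  _   = refl

  mid-⊕1 : ∀ {y} → y ≢ [ 0 ]ᵇ ⊖1 → mid (y ⊕ 1) ≡ y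
  mid-⊕1 {y} y≢[0]⊖1 = trans (mid-≢0 (λ y⊕1≡0 → y≢[0]⊖1 (trans (sym (⊕1-⊖1 y)) (cong _⊖1 y⊕1≡0))))
                             (⊕1-⊖1 y)

  mid-[0]≡mid-[1] : 1 < b → mid [ 0 ]ᵇ ≡ mid ([ 0 ]ᵇ ⊕ 1)
  mid-[0]≡mid-[1] 1<b = begin
    mid [ 0 ]ᵇ          ≡⟨ mid-[0] ⟩
    [ 0 ]ᵇ              ≡⟨ ⊕1-⊖1 [ 0 ]ᵇ ⟨
    ([ 0 ]ᵇ ⊕ 1) ⊖1     ≡⟨ mid-≢0 (x⊕k≢x [ 0 ]ᵇ (s≤s z≤n) 1<b) ⟨
    mid ([ 0 ]ᵇ ⊕ 1)    ∎

  mid-collision : 2 < b → ∀ x → mid x ≡ mid (x ⊕ 1) → x ≡ [ 0 ]ᵇ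
  mid-collision 2<b x e = go (x ≟ [ 0 ]ᵇ) (x ⊕ 1 ≟ [ 0 ]ᵇ)
    where
    x⊖1≡mid[x⊕1] : x ≢ [ 0 ]ᵇ → x ⊖1 ≡ mid (x ⊕ 1)
    x⊖1≡mid[x⊕1] x≢0 = trans (sym (mid-≢0 x≢0)) e

    go : Dec (x ≡ [ 0 ]ᵇ) → Dec (x ⊕ 1 ≡ [ 0 ]ᵇ) → x ≡ [ 0 ]ᵇ
    go (yes x≡0) _ = x≡0
    go (no x≢0) (yes x⊕1≡0) = ⊥-elim (x⊕k≢x x (s≤s z≤n) 2<b (sym (begin
      x            ≡⟨ ⊖1≡⇒≡⊕1 (trans (x⊖1≡mid[x⊕1] x≢0) (trans (cong mid x⊕1≡0) (trans mid-[0] (sym x⊕1≡0)))) ⟩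
      (x ⊕ 1) ⊕ 1  ≡⟨ ⊕-assoc x 1 1 ⟩
      x ⊕ 2        ∎)))
    go (no x≢0) (no x⊕1≢0) = ⊥-elim (x⊕k≢x x (s≤s z≤n) (≤-trans (n≤1+n 2) 2<b)
      (sym (⊖1≡⇒≡⊕1 (trans (x⊖1≡mid[x⊕1] x≢0) (trans (mid-≢0 x⊕1≢0) (⊕1-⊖1 x))))))

module Stabiliser
  (a b ℓ′ : ℕ) .{{_ : NonZero b}} (3≤b : 3 ≤ b) (0<a : 0 < a)
  (N : List (Tuple b (suc ℓ′))) (N-unique : Unique N) (|N| : length N ≡ a * b)
  (column-count : ∀ (i : Fin b) (j : Fin (2 + suc ℓ′)) → count (λ t → lookup t j ≟ i) N ≡ a)
  (T₀∈N : shape (suc ℓ′) [ 0 ]ᵇ [ 0 ]ᵇ [ 1 ]ᵇ ∈ N)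
  (Tₓ∈N : ∀ (x : Fin b) → x ≢ [ 0 ]ᵇ → shape (suc ℓ′) x (x ⊖1) (x ⊕ 1) ∈ N)
  (N∖T : ∀ t → t ∈ N → ¬ InT (suc ℓ′) t → last t ≢ head t ⊕ 1)
  (c : ℕ) (c≢1 : c ≢ 1)
  (diagonal : ∀ (x : Fin b) → count (λ t → (head t ≟ x) ×-dec (last t ≟ x)) N ≡ c)
  (off-diagonal : ∀ (x i : Fin b) → i ≢ [ 0 ]ᵇ → i ≢ [ 1 ]ᵇ →
     count (λ t → (head t ≟ x) ×-dec (last t ≟ x ⊕ toℕ i)) N ≢ 1
     × count (λ t → (head t ≟ x) ×-dec (last t ≟ x ⊕ toℕ i)) N ≢ c)
  where

  open ZMod b
  open Enumeration N |N|

  ℓ : ℕ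
  ℓ = suc ℓ′

  1<b : 1 < b
  1<b = ≤-trans (n≤1+n 2) 3≤b

  column : Fin (2 + ℓ) → Fin (a * b) → Fin b
  column j k = lookup (pt k) j

  column-partition : Fin (2 + ℓ) → Partition a b
  column-partition j = column j , λ i → trans (count-pt (λ t → lookup t j ≟ i)) (column-count i j)

  column-surjective : ∀ j i → ∃ λ k → column j k ≡ i
  column-surjective j i =
    satisfied (0<count⇒Any _ (allFin _) (subst (0 <_) (sym (proj₂ (column-partition j) i)) 0<a))

  τ : Fin b → Tuple b ℓ
  τ x = shape ℓ x (mid x) (x ⊕ 1)

  InT⇒≡τ : ∀ {t} → InT ℓ t → t ≡ τ (head t)
  InT⇒≡τ (inj₁ refl)              = cong₂ (shape ℓ [ 0 ]ᵇ) (sym mid-[0]) (sym ([k]⊕1≡[1+k] 0))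
  InT⇒≡τ (inj₂ (x , x≢0 , refl)) = cong (λ v → shape ℓ x v (x ⊕ 1)) (sym (mid-≢0 x≢0))

  τ∈N : ∀ x → τ x ∈ N
  τ∈N x = go (x ≟ [ 0 ]ᵇ)
    where
    go : Dec (x ≡ [ 0 ]ᵇ) → τ x ∈ N
    go (yes x≡0) = subst (λ z → τ z ∈ N) (sym x≡0) (subst (_∈ N) (InT⇒≡τ (inj₁ refl)) T₀∈N)
    go (no  x≢0) = subst (_∈ N) (InT⇒≡τ (inj₂ (x , x≢0 , refl))) (Tₓ∈N x x≢0)

  last≡head⊕1⇒≡τ : ∀ {t} → t ∈ N → last t ≡ head t ⊕ 1 → t ≡ τ (head t)
  last≡head⊕1⇒≡τ {t} t∈N last≡head⊕1 with ≡-dec _≟_ t (τ (head t))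
  ... | yes t≡τ = t≡τ
  ... | no  t≢τ = ⊥-elim (N∖T t t∈N (t≢τ ∘ InT⇒≡τ) last≡head⊕1)

  M : Fin b → Fin b → ℕ
  M x y = count (λ t → (head t ≟ x) ×-dec (last t ≟ y)) N

  M-succ : ∀ x → M x (x ⊕ 1) ≡ 1
  M-succ x = count≡1 _ N-unique (τ∈N x) (refl , last-shape ℓ x (mid x) (x ⊕ 1))
    λ u∈N (head≡x , last≡x⊕1) →
      trans (last≡head⊕1⇒≡τ u∈N (trans last≡x⊕1 (cong (_⊕ 1) (sym head≡x)))) (cong τ head≡x)

  M-off-diagonal : ∀ {x y} → y ≢ x → y ≢ x ⊕ 1 → M x y ≢ 1 × M x y ≢ c
  M-off-diagonal {x} {y} y≢x y≢x⊕1 with difference x y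
  ... | i , refl = off-diagonal x i
    (λ i≡0 → y≢x (trans (cong (x ⊕_) (trans (cong toℕ i≡0) toℕ-[0])) (⊕-identityʳ x)))
    (λ i≡1 → y≢x⊕1 (cong (x ⊕_) (trans (cong toℕ i≡1) (toℕ-[k] 1<b))))

  M≡c⇒≡ : ∀ {x y} → M x y ≡ c → y ≡ x
  M≡c⇒≡ {x} {y} e with y ≟ x | y ≟ x ⊕ 1
  ... | yes y≡x | _          = y≡x
  ... | no  _   | yes refl   = ⊥-elim (c≢1 (trans (sym e) (M-succ x)))
  ... | no  y≢x | no y≢x⊕1 = ⊥-elim (proj₂ (M-off-diagonal y≢x y≢x⊕1) e)

  M≡1⇒≡⊕1 : ∀ {x y} → M x y ≡ 1 → y ≡ x ⊕ 1
  M≡1⇒≡⊕1 {x} {y} e with y ≟ x | y ≟ x ⊕ 1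
  ... | _        | yes y≡x⊕1 = y≡x⊕1
  ... | yes refl | no  _     = ⊥-elim (c≢1 (trans (sym (diagonal x)) e))
  ... | no  y≢x  | no y≢x⊕1 = ⊥-elim (proj₁ (M-off-diagonal y≢x y≢x⊕1) e)

  module _ (σ : Permutation′ (a * b)) (σ-fixes : ∀ j → Fixes σ (column-partition j)) where

    π : Fin (2 + ℓ) → Fin b → Fin b
    π j = Induced.induced (column j) (column-surjective j) σ (σ-fixes j)

    π-comm : ∀ j k → column j (σ ⟨$⟩ʳ k) ≡ π j (column j k)
    π-comm j = Induced.induced-comm (column j) (column-surjective j) σ (σ-fixes j)

    π-injective : ∀ j {x y} → π j x ≡ π j y → x ≡ y
    π-injective j = Induced.induced-injective (column j) (column-surjective j) σ (σ-fixes j)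

    π₀ πₗ : Fin b → Fin b
    π₀ = π zero
    πₗ = π (fromℕ (suc ℓ))

    head-comm : ∀ k → head (pt (σ ⟨$⟩ʳ k)) ≡ π₀ (head (pt k))
    head-comm k = trans (head≡lookup-zero (pt (σ ⟨$⟩ʳ k)))
      (trans (π-comm zero k) (cong π₀ (sym (head≡lookup-zero (pt k)))))

    last-comm : ∀ k → last (pt (σ ⟨$⟩ʳ k)) ≡ πₗ (last (pt k))
    last-comm k = trans (last≡lookup-fromℕ (pt (σ ⟨$⟩ʳ k)))
      (trans (π-comm (fromℕ (suc ℓ)) k) (cong πₗ (sym (last≡lookup-fromℕ (pt k)))))

    M-invariant : ∀ x y → M x y ≡ M (π₀ x) (πₗ y)
    M-invariant x y = count-transport _ _ σ
      ( (λ (head≡x , last≡y) → trans (head-comm _) (cong π₀ head≡x) , trans (last-comm _) (cong πₗ last≡y))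
      , (λ (head≡ , last≡) → π-injective zero (trans (sym (head-comm _)) head≡)
                           , π-injective (fromℕ (suc ℓ)) (trans (sym (last-comm _)) last≡)))

    πₗ≡π₀ : ∀ x → πₗ x ≡ π₀ x
    πₗ≡π₀ x = M≡c⇒≡ (trans (sym (M-invariant x x)) (diagonal x))

    πₗ-⊕1 : ∀ x → πₗ (x ⊕ 1) ≡ π₀ x ⊕ 1
    πₗ-⊕1 x = M≡1⇒≡⊕1 (trans (sym (M-invariant x (x ⊕ 1))) (M-succ x))

    π₀-⊕1 : ∀ x → π₀ (x ⊕ 1) ≡ π₀ x ⊕ 1
    π₀-⊕1 x = trans (sym (πₗ≡π₀ (x ⊕ 1))) (πₗ-⊕1 x)

    σ-τ : ∀ {k x} → pt k ≡ τ x → pt (σ ⟨$⟩ʳ k) ≡ τ (π₀ x)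
    σ-τ {k} {x} pk≡τx = trans (last≡head⊕1⇒≡τ (pt-∈ _) last≡head⊕1) (cong τ head≡π₀x)
      where
      head≡π₀x : head (pt (σ ⟨$⟩ʳ k)) ≡ π₀ x
      head≡π₀x = trans (head-comm k) (cong (π₀ ∘ head) pk≡τx)

      last≡head⊕1 : last (pt (σ ⟨$⟩ʳ k)) ≡ head (pt (σ ⟨$⟩ʳ k)) ⊕ 1
      last≡head⊕1 = begin
        last (pt (σ ⟨$⟩ʳ k))      ≡⟨ last-comm k ⟩
        πₗ (last (pt k))          ≡⟨ cong (πₗ ∘ last) pk≡τx ⟩
        πₗ (last (τ x))           ≡⟨ cong πₗ (last-shape ℓ x (mid x) (x ⊕ 1)) ⟩
        πₗ (x ⊕ 1)                ≡⟨ πₗ-⊕1 x ⟩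
        π₀ x ⊕ 1                  ≡⟨ cong (_⊕ 1) head≡π₀x ⟨
        head (pt (σ ⟨$⟩ʳ k)) ⊕ 1  ∎

    π-τ : ∀ j x → π j (lookup (τ x) j) ≡ lookup (τ (π₀ x)) j
    π-τ j x with pt-surjective (τ∈N x)
    ... | k , pk≡τx = begin
      π j (lookup (τ x) j)  ≡⟨ cong (λ t → π j (lookup t j)) pk≡τx ⟨
      π j (column j k)      ≡⟨ π-comm j k ⟨
      column j (σ ⟨$⟩ʳ k)   ≡⟨ cong (λ t → lookup t j) (σ-τ pk≡τx) ⟩
      lookup (τ (π₀ x)) j   ∎

    π₀-[0] : π₀ [ 0 ]ᵇ ≡ [ 0 ]ᵇ
    π₀-[0] = mid-collision 3≤b (π₀ [ 0 ]ᵇ) (begin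
      mid (π₀ [ 0 ]ᵇ)           ≡⟨ π-τ j₁ [ 0 ]ᵇ ⟨
      π j₁ (mid [ 0 ]ᵇ)         ≡⟨ cong (π j₁) (mid-[0]≡mid-[1] 1<b) ⟩
      π j₁ (mid ([ 0 ]ᵇ ⊕ 1))   ≡⟨ π-τ j₁ ([ 0 ]ᵇ ⊕ 1) ⟩
      mid (π₀ ([ 0 ]ᵇ ⊕ 1))     ≡⟨ cong mid (π₀-⊕1 [ 0 ]ᵇ) ⟩
      mid (π₀ [ 0 ]ᵇ ⊕ 1)       ∎)
      where
      j₁ : Fin (2 + ℓ)
      j₁ = suc zero

    π₀-id : ∀ x → π₀ x ≡ x
    π₀-id = ⊕1-equivariant⇒id π₀-[0] π₀-⊕1

    π-id : ∀ j x → π j x ≡ x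
    π-id j with shape-coordinate ℓ j
    ... | inj₁ refl          = π₀-id
    ... | inj₂ (inj₁ refl)   = λ x → trans (πₗ≡π₀ x) (π₀-id x)
    ... | inj₂ (inj₂ middle) = fixes-all-but-one⇒id _≟_ (π-injective j) ([ 0 ]ᵇ ⊖1)
                                 λ y y≢[0]⊖1 → subst (λ z → π j z ≡ z) (mid-⊕1 y≢[0]⊖1) (fixes-mid (y ⊕ 1))
      where
      fixes-mid : ∀ x → π j (mid x) ≡ mid x
      fixes-mid x = begin
        π j (mid x)           ≡⟨ cong (π j) (middle x (mid x) (x ⊕ 1)) ⟨
        π j (lookup (τ x) j)  ≡⟨ π-τ j x ⟩
        lookup (τ (π₀ x)) j   ≡⟨ middle (π₀ x) (mid (π₀ x)) (π₀ x ⊕ 1) ⟩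
        mid (π₀ x)            ≡⟨ cong mid (π₀-id x) ⟩
        mid x                 ∎

    σ≡id : ∀ k → σ ⟨$⟩ʳ k ≡ k
    σ≡id k = pt-injective N-unique (Pointwise-≡⇒≡ (ext λ j → trans (π-comm j k) (π-id j _)))

  columns-form-base : IsBase (Vec.tabulate column-partition)
  columns-form-base σ σ-fixes = σ≡id σ (tabulate⁻ {f = column-partition} σ-fixes)

lemma3p3 : (a b ℓ : ℕ) → .{{_ : NonZero b}} → 2 ≤ a → 3 ≤ b → 1 ≤ ℓ →
  Σ (List (Tuple b ℓ)) (λ N →
    Unique N × length N ≡ a * b
    × (∀ (i : Fin b) (j : Fin (2 + ℓ)) → count (λ t → lookup t j ≟ i) N ≡ a)
    × shape ℓ [ 0 ]ᵇ [ 0 ]ᵇ [ 1 ]ᵇ ∈ N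
    × (∀ (x : Fin b) → x ≢ [ 0 ]ᵇ → shape ℓ x (x ⊖1) (x ⊕ 1) ∈ N)
    × (∀ t → t ∈ N → ¬ InT ℓ t → last t ≢ head t ⊕ 1)
    × ∃ λ (c : ℕ) → c ≢ 1
      × (∀ (x : Fin b) → count (λ t → (head t ≟ x) ×-dec (last t ≟ x)) N ≡ c)
      × (∀ (x i : Fin b) → i ≢ [ 0 ]ᵇ → i ≢ [ 1 ]ᵇ →
           count (λ t → (head t ≟ x) ×-dec (last t ≟ x ⊕ toℕ i)) N ≢ 1
           × count (λ t → (head t ≟ x) ×-dec (last t ≟ x ⊕ toℕ i)) N ≢ c))
  → BaseSize≤ a b (ℓ + 2)
lemma3p3 a b (suc ℓ′) 2≤a 3≤b (s≤s z≤n)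
         (N , N-unique , |N| , column-count , T₀∈N , Tₓ∈N , N∖T , c , c≢1 , diagonal , off-diagonal) =
  2 + suc ℓ′ , ≤-reflexive (+-comm 2 (suc ℓ′)) , _ , columns-form-base
  where
  open Stabiliser a b ℓ′ 3≤b (≤-trans (n≤1+n 1) 2≤a) N N-unique |N| column-count
                  T₀∈N Tₓ∈N N∖T c c≢1 diagonal off-diagonal
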